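{- For all $\varphi,\psi\in\mathcal L_{\Rrightarrow}$: $\Diamond^+(\varphi\veebar\psi)\equiv\Diamond^+\varphi\vee\Diamond^+\psi$.
   Context: Fix a set $\mathcal P$ of atoms. Formulas of $\mathcal L_{\Rrightarrow}$: $\varphi ::= p \mid \bot \mid (\varphi\wedge\varphi)\mid(\varphi\to\varphi)\mid(\varphi\veebar\varphi)\mid(\varphi\Rrightarrow\varphi)$, $p\in\mathcal P$, with $\veebar$ inquisitive disjunction; $\neg\varphi:=\varphi\to\bot$, $\varphi\vee\psi:=\neg(\neg\varphi\wedge\neg\psi)$, $\Diamond^+\varphi:=\neg(\varphi\Rrightarrow\bot)$. An in-model is $M=\langle W,\Sigma,V\rangle$ with $W$ nonempty, $\Sigma(w)$ a set of nonempty subsets of $W$, $V:W\times\mathcal P\to\{0,1\}$. Support at $s\subseteq W$: $M,s\models p$ iff $V(w,p)=1$ for all $w\in s$; $M,s\models\bot$ iff $s=\emptyset$; $\wedge$ conjunctively; $M,s\models\varphi\veebar\psi$ iff $M,s\models\varphi$ or $M,s\models\psi$; $M,s\models\varphi\to\psi$ iff for all $t\subseteq s$, $M,t\models\varphi$ implies $M,t\models\psi$; $M,s\models\varphi\Rrightarrow\psi$ iff for all $w\in s$, $t\in\Sigma(w)$, $M,t\models\varphi$ implies $M,t\models\psi$. $\varphi\equiv\psi$ means $M,s\models\varphi\iff M,s\models\psi$ for all in-models $M$ and states $s$. -}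

module Defs where

open import Level using (Level; 0ℓ) renaming (suc to lsuc)
open import Data.Bool using (Bool; true; false)
open import Data.Product using (Σ; ∃; _×_; _,_)
open import Data.Sum using (_⊎_)
open import Relation.Binary.PropositionalEquality using (_≡_)
open import Relation.Nullary using (¬_)

data Form (𝒫 : Set) : Set where
  atom : 𝒫 → Form 𝒫
  ⊥f   : Form 𝒫
  _∧f_ : Form 𝒫 → Form 𝒫 → Form 𝒫
  _→f_ : Form 𝒫 → Form 𝒫 → Form 𝒫
  _⊻f_ : Form 𝒫 → Form 𝒫 → Form 𝒫
  _⇛f_ : Form 𝒫 → Form 𝒫 → Form 𝒫

module _ {𝒫 : Set} where
  ¬f_ : Form 𝒫 → Form 𝒫
  ¬f φ = φ →f ⊥f

  _∨f_ : Form 𝒫 → Form 𝒫 → Form 𝒫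
  φ ∨f ψ = ¬f ((¬f φ) ∧f (¬f ψ))

  ◇⁺ : Form 𝒫 → Form 𝒫
  ◇⁺ φ = ¬f (φ ⇛f ⊥f)

-- States (subsets of W) are represented as predicates W → Set.
State : Set → Set₁
State W = W → Set

_⊆_ : {W : Set} → State W → State W → Set
s ⊆ t = ∀ w → s w → t w

Empty : {W : Set} → State W → Set
Empty s = ∀ w → ¬ s w

NonEmpty : {W : Set} → State W → Set
NonEmpty {W} s = Σ W s

record InModel (𝒫 : Set) : Set₁ where
  field
    W        : Set
    w₀       : W
    Σm       : W → State W → Set
    Σ-nonempty : ∀ w t → Σm w t → NonEmpty t
    V        : W → 𝒫 → Bool

module _ {𝒫 : Set} (M : InModel 𝒫) where
  open InModel M

  _⊨_ : State W → Form 𝒫 → Set₁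
  s ⊨ atom p  = Level.Lift _ (∀ w → s w → V w p ≡ true)
  s ⊨ ⊥f      = Level.Lift _ (Empty s)
  s ⊨ (φ ∧f ψ) = (s ⊨ φ) × (s ⊨ ψ)
  s ⊨ (φ →f ψ) = ∀ (t : State W) → t ⊆ s → t ⊨ φ → t ⊨ ψ
  s ⊨ (φ ⊻f ψ) = (s ⊨ φ) ⊎ (s ⊨ ψ)
  s ⊨ (φ ⇛f ψ) = ∀ (w : W) → s w → ∀ (t : State W) → Σm w t → t ⊨ φ → t ⊨ ψ

_≣_ : {𝒫 : Set} → Form 𝒫 → Form 𝒫 → Set₁
_≣_ {𝒫} φ ψ = ∀ (M : InModel 𝒫) (s : State (InModel.W M)) →
  ((_⊨_ M s φ → _⊨_ M s ψ) × (_⊨_ M s ψ → _⊨_ M s φ))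

{-# OPTIONS --safe #-}
module Submission where

-- Both sides are truth-conditional: a state supports them iff each of its
-- worlds satisfies a fixed condition.  Such conditions compose: ◇⁺χ holds at w
-- iff ¬¬(some state in Σ(w) supports χ), ¬ negates and ∧ conjoins.  Since a
-- state supports φ ⊻ ψ iff it supports φ or ψ, intuitionistic propositional
-- logic turns both conditions into ¬(¬ Possible w φ × ¬ Possible w ψ).

open import Defs
open import Level using (lift; lower)
open import Data.Empty using (⊥-elim)
open import Data.Product using (Σ; _×_; _,_; uncurry)
open import Data.Sum using (_⊎_; inj₁; inj₂)
open import Function using (_∘_)
open import Function.Bundles using (_⇔_; mk⇔; Equivalence)
open import Function.Properties.Equivalence using () renaming (trans to ⇔-trans)
open import Function.Related.TypeIsomorphisms using (¬-cong-⇔)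
open import Relation.Nullary using (¬_)
open import Relation.Nullary.Negation using (contradiction; negated-stable; _¬-⊎_)
open import Relation.Binary.PropositionalEquality using (_≡_; refl)

¬¬-⊎⇔¬[¬×¬] : ∀ {a b} {A : Set a} {B : Set b} → (¬ ¬ (A ⊎ B)) ⇔ (¬ (¬ A × ¬ B))
¬¬-⊎⇔¬[¬×¬] = ¬-cong-⇔ (mk⇔ (λ ¬a⊎b → ¬a⊎b ∘ inj₁ , ¬a⊎b ∘ inj₂) (uncurry _¬-⊎_))

module TruthConditions {𝒫 : Set} (M : InModel 𝒫) where
  open InModel M

  _⊨ᴹ_ : State W → Form 𝒫 → Set₁
  _⊨ᴹ_ = _⊨_ M

  record HasTruthCondition (χ : Form 𝒫) (P : W → Set₁) : Set₁ where
    constructor truthCondition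
    field supported⇔ : ∀ s → s ⊨ᴹ χ ⇔ (∀ w → s w → P w)

    supported⇒ : ∀ {s} → s ⊨ᴹ χ → ∀ w → s w → P w
    supported⇒ {s} = Equivalence.to (supported⇔ s)

    supported⇐ : ∀ {s} → (∀ w → s w → P w) → s ⊨ᴹ χ
    supported⇐ {s} = Equivalence.from (supported⇔ s)
  open HasTruthCondition

  Possible : W → Form 𝒫 → Set₁
  Possible w χ = Σ (State W) λ t → Σm w t × t ⊨ᴹ χ

  _↾_ : State W → W → State W
  (s ↾ w) v = s v × v ≡ w

  ↾-⊆ : ∀ {s w} → (s ↾ w) ⊆ s
  ↾-⊆ v (v∈s , _) = v∈s

  truthCondition-cong : ∀ {χ P Q} → (∀ w → P w ⇔ Q w) →
                        HasTruthCondition χ P → HasTruthCondition χ Q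
  truthCondition-cong P⇔Q tc = truthCondition λ s → mk⇔
    (λ s⊨χ w w∈s → Equivalence.to (P⇔Q w) (supported⇒ tc s⊨χ w w∈s))
    (λ Q-on-s → supported⇐ tc λ w w∈s → Equivalence.from (P⇔Q w) (Q-on-s w w∈s))

  sameTruthCondition⇒⇔ : ∀ {χ θ P} → HasTruthCondition χ P → HasTruthCondition θ P →
                         ∀ s → s ⊨ᴹ χ ⇔ s ⊨ᴹ θ
  sameTruthCondition⇒⇔ tcχ tcθ s = mk⇔ (supported⇐ tcθ ∘ supported⇒ tcχ) (supported⇐ tcχ ∘ supported⇒ tcθ)

  truthCondition-∧ : ∀ {χ θ P Q} → HasTruthCondition χ P → HasTruthCondition θ Q →
                     HasTruthCondition (χ ∧f θ) (λ w → P w × Q w)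
  truthCondition-∧ tcχ tcθ = truthCondition λ s → mk⇔
    (λ (s⊨χ , s⊨θ) w w∈s → supported⇒ tcχ s⊨χ w w∈s , supported⇒ tcθ s⊨θ w w∈s)
    (λ PQ-on-s → supported⇐ tcχ (λ w w∈s → let (Pw , _) = PQ-on-s w w∈s in Pw)
               , supported⇐ tcθ (λ w w∈s → let (_ , Qw) = PQ-on-s w w∈s in Qw))

  -- For w ∈ s, the sub-state s ↾ w = {w} shows that s ⊨ ¬χ forbids P at w.
  truthCondition-¬ : ∀ {χ P} → HasTruthCondition χ P → HasTruthCondition (¬f χ) (λ w → ¬ P w)
  truthCondition-¬ {χ} {P} tc = truthCondition λ s → mk⇔ (to s) (from s)
    where
    to : ∀ s → s ⊨ᴹ (¬f χ) → ∀ w → s w → ¬ P w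
    to s s⊨¬χ w w∈s Pw = lower (s⊨¬χ (s ↾ w) ↾-⊆ s↾w⊨χ) w (w∈s , refl)
      where
      s↾w⊨χ : (s ↾ w) ⊨ᴹ χ
      s↾w⊨χ = supported⇐ tc λ { v (_ , refl) → Pw }
    from : ∀ s → (∀ w → s w → ¬ P w) → s ⊨ᴹ (¬f χ)
    from s ¬P t t⊆s t⊨χ = lift λ v v∈t → ¬P v (t⊆s v v∈t) (supported⇒ tc t⊨χ v v∈t)

  -- Every state in Σ(w) is nonempty, so none of them supports ⊥.
  truthCondition-⇛⊥ : ∀ χ → HasTruthCondition (χ ⇛f ⊥f) (λ w → ¬ Possible w χ)
  truthCondition-⇛⊥ χ = truthCondition λ s → mk⇔
    (λ s⊨χ⇛⊥ w w∈s (t , σ , t⊨χ) →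
       let (v , v∈t) = Σ-nonempty w t σ in lower (s⊨χ⇛⊥ w w∈s t σ t⊨χ) v v∈t)
    (λ ¬possible w w∈s t σ t⊨χ → ⊥-elim (¬possible w w∈s (t , σ , t⊨χ)))

  truthCondition-◇⁺ : ∀ χ → HasTruthCondition (◇⁺ χ) (λ w → ¬ ¬ Possible w χ)
  truthCondition-◇⁺ χ = truthCondition-¬ (truthCondition-⇛⊥ χ)

  truthCondition-¬◇⁺ : ∀ χ → HasTruthCondition (¬f ◇⁺ χ) (λ w → ¬ Possible w χ)
  truthCondition-¬◇⁺ χ =
    truthCondition-cong (λ _ → mk⇔ negated-stable contradiction) (truthCondition-¬ (truthCondition-◇⁺ χ))

  Possible-⊻ : ∀ w φ ψ → Possible w (φ ⊻f ψ) ⇔ (Possible w φ ⊎ Possible w ψ)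
  Possible-⊻ w φ ψ = mk⇔ to from
    where
    to : Possible w (φ ⊻f ψ) → Possible w φ ⊎ Possible w ψ
    to (t , σ , inj₁ t⊨φ) = inj₁ (t , σ , t⊨φ)
    to (t , σ , inj₂ t⊨ψ) = inj₂ (t , σ , t⊨ψ)
    from : Possible w φ ⊎ Possible w ψ → Possible w (φ ⊻f ψ)
    from (inj₁ (t , σ , t⊨φ)) = t , σ , inj₁ t⊨φ
    from (inj₂ (t , σ , t⊨ψ)) = t , σ , inj₂ t⊨ψ

proposition3p2 : {𝒫 : Set} (φ ψ : Form 𝒫) → ◇⁺ (φ ⊻f ψ) ≣ (◇⁺ φ ∨f ◇⁺ ψ)
proposition3p2 φ ψ M s = Equivalence.to ⊨⇔⊨ , Equivalence.from ⊨⇔⊨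
  where
  open TruthConditions M

  notNeitherPossible : InModel.W M → Set₁
  notNeitherPossible w = ¬ (¬ Possible w φ × ¬ Possible w ψ)

  ◇⁺⊻-condition : HasTruthCondition (◇⁺ (φ ⊻f ψ)) notNeitherPossible
  ◇⁺⊻-condition = truthCondition-cong
    (λ w → ⇔-trans (¬-cong-⇔ (¬-cong-⇔ (Possible-⊻ w φ ψ))) ¬¬-⊎⇔¬[¬×¬])
    (truthCondition-◇⁺ (φ ⊻f ψ))

  ◇⁺∨◇⁺-condition : HasTruthCondition (◇⁺ φ ∨f ◇⁺ ψ) notNeitherPossible
  ◇⁺∨◇⁺-condition = truthCondition-¬ (truthCondition-∧ (truthCondition-¬◇⁺ φ) (truthCondition-¬◇⁺ ψ))

  ⊨⇔⊨ : s ⊨ᴹ ◇⁺ (φ ⊻f ψ) ⇔ s ⊨ᴹ (◇⁺ φ ∨f ◇⁺ ψ)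
  ⊨⇔⊨ = sameTruthCondition⇒⇔ ◇⁺⊻-condition ◇⁺∨◇⁺-condition s
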